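{- In every row $r\ge1$ of the extended Trithoff array, the wall term $w=T_{r,0}$ is followed by $\operatorname{out}(w)-1$; that is, $T_{r,1}=\operatorname{out}(T_{r,0})-1$.
   Context: Tribonacci numbers: $T_0=0,T_1=0,T_2=1$, $T_n=T_{n-1}+T_{n-2}+T_{n-3}$ ($n\ge3$). Every $N\ge0$ has a unique canonical Tribonacci representation $N=\sum_i d_iT_{i+3}$, $d_i\in\{0,1\}$, no three consecutive $d_i$ equal to $1$; the Tribonacci successor is $\operatorname{out}(N)=\sum_i d_iT_{i+4}$. Trithoff array: $T_{r,1}$ is the $r$-th smallest positive integer whose canonical representation has last digit $d_0=1$, and $T_{r,c+1}=\operatorname{out}(T_{r,c})$ for $c\ge1$; each row satisfies the Tribonacci rule, and is extended to the left by it: $T_{r,0}=T_{r,3}-T_{r,2}-T_{r,1}$ is the wall term of row $r$. -}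

module Defs where

open import Data.Nat using (ℕ; zero; suc; _+_; _*_; _<_; _≤_; _∸_)
open import Data.Bool using (Bool; true; false)
open import Data.List using (List; []; _∷_; length)
open import Data.List.Membership.Propositional using (_∈_)
open import Data.List.Relation.Unary.Unique.Propositional using (Unique)
open import Data.Product using (Σ; _×_; ∃)
open import Data.Unit using (⊤)
open import Data.Empty using (⊥)
open import Function.Bundles using (_⇔_)
open import Relation.Binary.PropositionalEquality using (_≡_)

T : ℕ → ℕ
T 0 = 0
T 1 = 0
T 2 = 1
T (suc (suc (suc n))) = T (suc (suc n)) + T (suc n) + T n

-- A digit string is a list of bits d_0 ∷ d_1 ∷ d_2 ∷ … (least significant first).
bit : Bool → ℕ
bit true  = 1
bit false = 0

valFrom : ℕ → List Bool → ℕ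
valFrom k []       = 0
valFrom k (d ∷ ds) = bit d * T k + valFrom (suc k) ds

val : List Bool → ℕ
val = valFrom 3

shiftVal : List Bool → ℕ
shiftVal = valFrom 4

NoThree : List Bool → Set
NoThree []                          = ⊤
NoThree (true ∷ true ∷ true ∷ _)    = ⊥
NoThree (true ∷ true ∷ false ∷ ds)  = NoThree (false ∷ ds)
NoThree (true ∷ true ∷ [])          = ⊤
NoThree (true ∷ false ∷ ds)         = NoThree (false ∷ ds)
NoThree (true ∷ [])                 = ⊤
NoThree (false ∷ ds)                = NoThree ds

IsRep : ℕ → List Bool → Set
IsRep N ds = NoThree ds × val ds ≡ N

-- out N ≡ M  (Tribonacci successor, read off the canonical representation)
Out : ℕ → ℕ → Set
Out N M = Σ (List Bool) λ ds → IsRep N ds × shiftVal ds ≡ M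

LastDigitOne : ℕ → Set
LastDigitOne N = Σ (List Bool) λ ds → IsRep N (true ∷ ds)

-- a is the r-th smallest positive integer whose canonical representation
-- has d_0 = 1 (r ≥ 1): a is such an integer and exactly r - 1 such integers
-- lie strictly below a.
IsRthLastOne : ℕ → ℕ → Set
IsRthLastOne r a =
  0 < a × LastDigitOne a ×
  Σ (List ℕ) λ xs → Unique xs × length xs ≡ r ∸ 1 ×
    (∀ m → (m ∈ xs) ⇔ (0 < m × m < a × LastDigitOne m))

-- Write d = 1·e for the canonical representation of a = T_{r,1}, so a = Σ d_i T_{i+3}.
-- Representations are unique (a canonical word of length n has value below T_{n+3},
-- so the leading digits must agree), hence b = out a = Σ d_i T_{i+4}, and since 0·d is again
-- canonical, c = out b = Σ d_i T_{i+5}.  Applying the Tribonacci recurrence digitwise,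
-- c = w + a + b with w = Σ d_i T_{i+2} = 1 + Σ e_i T_{i+3}.  Finally out w = a + 1: the
-- digit string e with an extra 1 in front has the same value as w, and after the carry
-- 111 ↦ 0001 it becomes canonical without changing its shifted value.
module Submission where

open import Defs
open import Data.Nat using (ℕ; zero; suc; _+_; _*_; _∸_; _≤_; _<_; z≤n; _≤′_; ≤′-refl; ≤′-step)
open import Data.Nat.Properties
open import Data.Nat.Tactic.RingSolver using (solve-∀)
open import Data.Bool using (Bool; true; false)
open import Data.List using (List; []; _∷_; [_]; length; _∷ʳ_)
open import Data.List.Properties using (length-++)
open import Data.List.Reverse using (Reverse; []; _∶_∶ʳ_; reverseView)
open import Data.Product using (Σ; _×_; _,_)
open import Data.Unit using (tt)
open import Data.Empty using (⊥-elim)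
open import Function using (_∘_)
open import Relation.Binary.Definitions using (tri<; tri≈; tri>)
open import Relation.Binary.PropositionalEquality
  using (_≡_; refl; sym; trans; cong; cong₂; subst; module ≡-Reasoning)

T-≤-suc : ∀ n → T n ≤ T (suc n)
T-≤-suc 0 = z≤n
T-≤-suc 1 = z≤n
T-≤-suc 2 = ≤-refl
T-≤-suc (suc (suc (suc n))) =
  ≤-trans (m≤m+n (T (3 + n)) (T (2 + n))) (m≤m+n _ (T (1 + n)))

T-mono-≤′ : ∀ {m n} → m ≤′ n → T m ≤ T n
T-mono-≤′ ≤′-refl = ≤-refl
T-mono-≤′ (≤′-step {n} m≤′n) = ≤-trans (T-mono-≤′ m≤′n) (T-≤-suc n)

T-mono-≤ : ∀ {m n} → m ≤ n → T m ≤ T n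
T-mono-≤ = T-mono-≤′ ∘ ≤⇒≤′

T[1+n]+T[n]≤T[2+n] : ∀ n → T (suc n) + T n ≤ T (2 + n)
T[1+n]+T[n]≤T[2+n] zero    = z≤n
T[1+n]+T[n]≤T[2+n] (suc n) = m≤m+n _ _

valFrom-true∷ : ∀ k ds → valFrom k (true ∷ ds) ≡ T k + valFrom (suc k) ds
valFrom-true∷ k ds = cong (_+ valFrom (suc k) ds) (*-identityˡ (T k))

valFrom-true∷true∷ : ∀ k ds → valFrom k (true ∷ true ∷ ds) ≡ T k + T (suc k) + valFrom (2 + k) ds
valFrom-true∷true∷ k ds = begin
  valFrom k (true ∷ true ∷ ds)          ≡⟨ valFrom-true∷ k (true ∷ ds) ⟩
  T k + valFrom (suc k) (true ∷ ds)     ≡⟨ cong (T k +_) (valFrom-true∷ (suc k) ds) ⟩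
  T k + (T (suc k) + valFrom (2 + k) ds) ≡⟨ sym (+-assoc (T k) _ _) ⟩
  T k + T (suc k) + valFrom (2 + k) ds  ∎
  where open ≡-Reasoning

valFrom-∷ʳ : ∀ k xs x → valFrom k (xs ∷ʳ x) ≡ valFrom k xs + bit x * T (k + length xs)
valFrom-∷ʳ k []       x = trans (+-identityʳ _) (cong (λ n → bit x * T n) (sym (+-identityʳ k)))
valFrom-∷ʳ k (y ∷ xs) x = begin
  bit y * T k + valFrom (suc k) (xs ∷ʳ x)
    ≡⟨ cong (bit y * T k +_) (valFrom-∷ʳ (suc k) xs x) ⟩
  bit y * T k + (valFrom (suc k) xs + bit x * T (suc k + length xs))
    ≡⟨ sym (+-assoc (bit y * T k) _ _) ⟩
  bit y * T k + valFrom (suc k) xs + bit x * T (suc k + length xs)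
    ≡⟨ cong (λ n → bit y * T k + valFrom (suc k) xs + bit x * T n) (sym (+-suc k (length xs))) ⟩
  bit y * T k + valFrom (suc k) xs + bit x * T (k + suc (length xs)) ∎
  where open ≡-Reasoning

valFrom-∷ʳ-false : ∀ k xs → valFrom k (xs ∷ʳ false) ≡ valFrom k xs
valFrom-∷ʳ-false k xs = trans (valFrom-∷ʳ k xs false) (+-identityʳ _)

T-≤-valFrom-∷ʳ-true : ∀ k xs → T (k + length xs) ≤ valFrom k (xs ∷ʳ true)
T-≤-valFrom-∷ʳ-true k xs = begin
  T (k + length xs)                    ≡⟨ sym (*-identityˡ _) ⟩
  1 * T (k + length xs)                ≤⟨ m≤n+m _ (valFrom k xs) ⟩
  valFrom k xs + 1 * T (k + length xs) ≡⟨ sym (valFrom-∷ʳ k xs true) ⟩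
  valFrom k (xs ∷ʳ true)               ∎
  where open ≤-Reasoning

valFrom-recurrence : ∀ n ds →
  valFrom (3 + n) ds ≡ valFrom n ds + valFrom (1 + n) ds + valFrom (2 + n) ds
valFrom-recurrence n []       = refl
valFrom-recurrence n (d ∷ ds) = begin
  bit d * (T (2 + n) + T (1 + n) + T n) + valFrom (4 + n) ds
    ≡⟨ cong (bit d * (T (2 + n) + T (1 + n) + T n) +_) (valFrom-recurrence (suc n) ds) ⟩
  bit d * (T (2 + n) + T (1 + n) + T n) + (valFrom (1 + n) ds + valFrom (2 + n) ds + valFrom (3 + n) ds)
    ≡⟨ rearrange (bit d) (T (2 + n)) (T (1 + n)) (T n) _ _ _ ⟩
  (bit d * T n + valFrom (1 + n) ds) + (bit d * T (1 + n) + valFrom (2 + n) ds)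
    + (bit d * T (2 + n) + valFrom (3 + n) ds) ∎
  where
  open ≡-Reasoning
  rearrange : ∀ b x y z p q r → b * (x + y + z) + (p + q + r) ≡ (b * z + p) + (b * y + q) + (b * x + r)
  rearrange = solve-∀

noThree-init : ∀ xs x → NoThree (xs ∷ʳ x) → NoThree xs
noThree-init []                         x _  = tt
noThree-init (false ∷ xs)               x nt = noThree-init xs x nt
noThree-init (true ∷ [])                x _  = tt
noThree-init (true ∷ false ∷ xs)        x nt = noThree-init (false ∷ xs) x nt
noThree-init (true ∷ true ∷ [])         x _  = tt
noThree-init (true ∷ true ∷ false ∷ xs) x nt = noThree-init (false ∷ xs) x nt

-- The summand T k is what makes the bound strong enough to go through by induction.
valFrom-bound : ∀ k ds → NoThree ds → valFrom (suc k) ds + T k ≤ T (suc k + length ds)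
valFrom-bound k [] _ = begin
  T k              ≤⟨ T-≤-suc k ⟩
  T (suc k)        ≡⟨ cong (T ∘ suc) (sym (+-identityʳ k)) ⟩
  T (suc k + 0)    ∎
  where open ≤-Reasoning
valFrom-bound k (false ∷ ds) nt = begin
  valFrom (2 + k) ds + T k           ≤⟨ +-monoʳ-≤ _ (T-≤-suc k) ⟩
  valFrom (2 + k) ds + T (suc k)     ≤⟨ valFrom-bound (suc k) ds nt ⟩
  T (2 + k + length ds)              ≡⟨ cong T (sym (+-suc (suc k) (length ds))) ⟩
  T (suc k + suc (length ds))        ∎
  where open ≤-Reasoning
valFrom-bound k (true ∷ []) _ = begin
  valFrom (suc k) [ true ] + T k     ≡⟨ cong (_+ T k) (trans (valFrom-true∷ (suc k) []) (+-identityʳ _)) ⟩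
  T (suc k) + T k                    ≤⟨ T[1+n]+T[n]≤T[2+n] k ⟩
  T (2 + k)                          ≡⟨ cong T (+-comm 1 (suc k)) ⟩
  T (suc k + 1)                      ∎
  where open ≤-Reasoning
valFrom-bound k (true ∷ false ∷ ds) nt = begin
  valFrom (suc k) (true ∷ false ∷ ds) + T k
    ≡⟨ cong (_+ T k) (valFrom-true∷ (suc k) (false ∷ ds)) ⟩
  T (suc k) + valFrom (3 + k) ds + T k
    ≡⟨ rearrange (T (suc k)) _ (T k) ⟩
  valFrom (3 + k) ds + (T (suc k) + T k)
    ≤⟨ +-monoʳ-≤ _ (T[1+n]+T[n]≤T[2+n] k) ⟩
  valFrom (3 + k) ds + T (2 + k)
    ≤⟨ valFrom-bound (2 + k) ds nt ⟩
  T (3 + k + length ds)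
    ≡⟨ cong T (sym (trans (+-suc (suc k) (suc (length ds))) (cong suc (+-suc (suc k) (length ds))))) ⟩
  T (suc k + suc (suc (length ds))) ∎
  where
  open ≤-Reasoning
  rearrange : ∀ a v b → a + v + b ≡ v + (a + b)
  rearrange = solve-∀
valFrom-bound k (true ∷ true ∷ []) _ = ≤-reflexive (begin
  valFrom (suc k) (true ∷ true ∷ []) + T k
    ≡⟨ cong (_+ T k) (valFrom-true∷true∷ (suc k) []) ⟩
  T (suc k) + T (2 + k) + 0 + T k
    ≡⟨ rearrange (T (suc k)) (T (2 + k)) (T k) ⟩
  T (3 + k)
    ≡⟨ cong T (+-comm 2 (suc k)) ⟩
  T (suc k + 2) ∎)
  where
  open ≡-Reasoning
  rearrange : ∀ a b c → a + b + 0 + c ≡ b + a + c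
  rearrange = solve-∀
valFrom-bound k (true ∷ true ∷ false ∷ ds) nt = begin
  valFrom (suc k) (true ∷ true ∷ false ∷ ds) + T k
    ≡⟨ cong (_+ T k) (valFrom-true∷true∷ (suc k) (false ∷ ds)) ⟩
  T (suc k) + T (2 + k) + valFrom (4 + k) ds + T k
    ≡⟨ rearrange (T (suc k)) (T (2 + k)) _ (T k) ⟩
  valFrom (4 + k) ds + T (3 + k)
    ≤⟨ valFrom-bound (3 + k) ds nt ⟩
  T (4 + k + length ds)
    ≡⟨ cong T (sym (reindex (suc k) (length ds))) ⟩
  T (suc k + (3 + length ds)) ∎
  where
  open ≤-Reasoning
  rearrange : ∀ a b v c → a + b + v + c ≡ v + (b + a + c)
  rearrange = solve-∀
  reindex : ∀ m n → m + (3 + n) ≡ 3 + m + n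
  reindex = solve-∀

val-<-T : ∀ ds → NoThree ds → val ds < T (3 + length ds)
val-<-T ds nt = subst (_≤ T (3 + length ds)) (+-comm (val ds) 1) (valFrom-bound 2 ds nt)

val-<-val-∷ʳ-true : ∀ es xs → NoThree es → length es ≤ length xs → val es < val (xs ∷ʳ true)
val-<-val-∷ʳ-true es xs nt es≤xs = begin-strict
  val es                 <⟨ val-<-T es nt ⟩
  T (3 + length es)      ≤⟨ T-mono-≤ (+-monoʳ-≤ 3 es≤xs) ⟩
  T (3 + length xs)      ≤⟨ T-≤-valFrom-∷ʳ-true 3 xs ⟩
  val (xs ∷ʳ true)       ∎
  where open ≤-Reasoning

length-∷ʳ-≤ : ∀ {n} xs (x : Bool) → length xs < n → length (xs ∷ʳ x) ≤ n
length-∷ʳ-≤ {n} xs x = subst (_≤ n) (trans (+-comm 1 (length xs)) (sym (length-++ xs)))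

length-determined : ∀ xs ys → NoThree (xs ∷ʳ true) → NoThree (ys ∷ʳ true) →
  val (xs ∷ʳ true) ≡ val (ys ∷ʳ true) → length xs ≡ length ys
length-determined xs ys nx ny eq with <-cmp (length xs) (length ys)
... | tri< xs<ys _ _ =
  ⊥-elim (<⇒≢ (val-<-val-∷ʳ-true (xs ∷ʳ true) ys nx (length-∷ʳ-≤ xs true xs<ys)) eq)
... | tri≈ _ xs≡ys _ = xs≡ys
... | tri> _ _ ys<xs =
  ⊥-elim (<⇒≢ (val-<-val-∷ʳ-true (ys ∷ʳ true) xs ny (length-∷ʳ-≤ ys true ys<xs)) (sym eq))

valFrom-unique : ∀ {ds es} → Reverse ds → Reverse es → NoThree ds → NoThree es →
  val ds ≡ val es → ∀ j → valFrom j ds ≡ valFrom j es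
valFrom-unique [] [] _ _ _ _ = refl
valFrom-unique (xs ∶ rx ∶ʳ false) re nx ne eq j =
  trans (valFrom-∷ʳ-false j xs)
        (valFrom-unique rx re (noThree-init xs false nx) ne (trans (sym (valFrom-∷ʳ-false 3 xs)) eq) j)
valFrom-unique rd (ys ∶ ry ∶ʳ false) nd ny eq j =
  trans (valFrom-unique rd ry nd (noThree-init ys false ny) (trans eq (valFrom-∷ʳ-false 3 ys)) j)
        (sym (valFrom-∷ʳ-false j ys))
valFrom-unique [] (ys ∶ _ ∶ʳ true) _ _ eq _ =
  ⊥-elim (<⇒≢ (val-<-val-∷ʳ-true [] ys tt z≤n) eq)
valFrom-unique (xs ∶ _ ∶ʳ true) [] _ _ eq _ =
  ⊥-elim (<⇒≢ (val-<-val-∷ʳ-true [] xs tt z≤n) (sym eq))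
valFrom-unique (xs ∶ rx ∶ʳ true) (ys ∶ ry ∶ʳ true) nx ny eq j = begin
  valFrom j (xs ∷ʳ true)                ≡⟨ valFrom-∷ʳ j xs true ⟩
  valFrom j xs + 1 * T (j + length xs)  ≡⟨ cong₂ _+_ (init-equal j) (cong (λ n → 1 * T (j + n)) xs≡ys) ⟩
  valFrom j ys + 1 * T (j + length ys)  ≡⟨ sym (valFrom-∷ʳ j ys true) ⟩
  valFrom j (ys ∷ʳ true)                ∎
  where
  open ≡-Reasoning
  xs≡ys : length xs ≡ length ys
  xs≡ys = length-determined xs ys nx ny eq
  init-val : val xs ≡ val ys
  init-val = +-cancelʳ-≡ (1 * T (3 + length ys)) _ _ (begin
    val xs + 1 * T (3 + length ys) ≡⟨ cong (λ n → val xs + 1 * T (3 + n)) (sym xs≡ys) ⟩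
    val xs + 1 * T (3 + length xs) ≡⟨ sym (valFrom-∷ʳ 3 xs true) ⟩
    val (xs ∷ʳ true)               ≡⟨ eq ⟩
    val (ys ∷ʳ true)               ≡⟨ valFrom-∷ʳ 3 ys true ⟩
    val ys + 1 * T (3 + length ys) ∎)
  init-equal : ∀ j → valFrom j xs ≡ valFrom j ys
  init-equal = valFrom-unique rx ry (noThree-init xs true nx) (noThree-init ys true ny) init-val

out-determined : ∀ {N M ds} → IsRep N ds → Out N M → M ≡ shiftVal ds
out-determined {ds = ds} (nd , refl) (es , (ne , ves) , refl) =
  valFrom-unique (reverseView es) (reverseView ds) ne nd ves 4

valFrom-carry : ∀ k ds →
  valFrom k (true ∷ true ∷ true ∷ false ∷ ds) ≡ valFrom k (false ∷ false ∷ false ∷ true ∷ ds)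
valFrom-carry k ds = begin
  valFrom k (true ∷ true ∷ true ∷ false ∷ ds)
    ≡⟨ valFrom-true∷true∷ k (true ∷ false ∷ ds) ⟩
  T k + T (suc k) + valFrom (2 + k) (true ∷ false ∷ ds)
    ≡⟨ cong (T k + T (suc k) +_) (valFrom-true∷ (2 + k) (false ∷ ds)) ⟩
  T k + T (suc k) + (T (2 + k) + valFrom (4 + k) ds)
    ≡⟨ rearrange (T k) (T (suc k)) (T (2 + k)) _ ⟩
  T (3 + k) + valFrom (4 + k) ds
    ≡⟨ sym (valFrom-true∷ (3 + k) ds) ⟩
  valFrom k (false ∷ false ∷ false ∷ true ∷ ds) ∎
  where
  open ≡-Reasoning
  rearrange : ∀ a b c v → a + b + (c + v) ≡ c + b + a + v
  rearrange = solve-∀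

canonical-true∷ : ∀ ds → NoThree ds →
  Σ (List Bool) λ cs → NoThree cs × (∀ k → valFrom k cs ≡ valFrom k (true ∷ ds))
canonical-true∷ []                  _  = true ∷ [] , tt , λ _ → refl
canonical-true∷ (false ∷ ds)        nt = true ∷ false ∷ ds , nt , λ _ → refl
canonical-true∷ (true ∷ [])         _  = true ∷ true ∷ [] , tt , λ _ → refl
canonical-true∷ (true ∷ false ∷ ds) nt = true ∷ true ∷ false ∷ ds , nt , λ _ → refl
canonical-true∷ (true ∷ true ∷ [])  _  =
  false ∷ false ∷ false ∷ true ∷ [] , tt , λ k → sym (valFrom-carry k [])
canonical-true∷ (true ∷ true ∷ false ∷ ds) nt with canonical-true∷ ds nt
... | cs , nc , cs≈ = false ∷ false ∷ false ∷ cs , nc ,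
  λ k → trans (cs≈ (3 + k)) (sym (valFrom-carry k ds))

out-wall : ∀ ds → NoThree (true ∷ ds) → Out (valFrom 2 (true ∷ ds)) (suc (valFrom 3 (true ∷ ds)))
out-wall []                  _  = true ∷ [] , (tt , refl) , refl
out-wall (false ∷ ds)        nt with canonical-true∷ ds nt
... | cs , nc , cs≈ = cs , (nc , cs≈ 3) , cs≈ 4
out-wall (true ∷ [])         _  = false ∷ true ∷ [] , (tt , refl) , refl
out-wall (true ∷ false ∷ ds) nt with canonical-true∷ ds nt
... | cs , nc , cs≈ = false ∷ cs , (nc , cs≈ 4) , cs≈ 5

c≡w+a+b⇒c∸b∸a≡w : ∀ {w a b c} → c ≡ w + a + b → (a + b ≤ c) × (c ∸ b ∸ a ≡ w)
c≡w+a+b⇒c∸b∸a≡w {w} {a} {b} refl =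
  subst (a + b ≤_) (sym (+-assoc w a b)) (m≤n+m (a + b) w) ,
  trans (cong (_∸ a) (m+n∸n≡m (w + a) b)) (m+n∸n≡m w a)

mainTheorem12 : (r a b c : ℕ) → 1 ≤ r → IsRthLastOne r a → Out a b → Out b c →
    (a + b ≤ c) × Σ ℕ (λ o → Out (c ∸ b ∸ a) o × o ≡ suc a)
mainTheorem12 _ _ _ _ _ (_ , (e , rep-a@(nd , refl)) , _) out-a out-b
  with refl ← out-determined {ds = true ∷ e} rep-a out-a
  with refl ← out-determined {ds = false ∷ true ∷ e} (nd , refl) out-b
  with a+b≤c , wall ← c≡w+a+b⇒c∸b∸a≡w (valFrom-recurrence 2 (true ∷ e)) =
  a+b≤c , (_ , subst (λ n → Out n (suc (val (true ∷ e)))) (sym wall) (out-wall e nd) , refl)
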